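{- Fix integers $n\ge0$ and $j\ge2$. If the nonzero entries of some row $i$ of $F$, read from left to right, form the sequence $R(j)$, then the nonzero entries of row $i+1$ of $F$, read from left to right, form the sequence $R(j-1)$.
   Context: For a fixed integer $n\ge0$, define $F:\mathbb{Z}^2\to\mathbb{Z}_{\ge0}$ by $F(0,0)=2^n$, $F(x,y)=\lfloor F(x-1,y)/2\rfloor+\lfloor F(x,y-1)/2\rfloor$ for every $(x,y)\in\mathbb{Z}_{\ge0}^2\setminus\{(0,0)\}$, and $F(x,y)=0$ for $(x,y)$ outside the first quadrant (the intermediate firing configuration of chip-firing on the quadrant lattice graph started with $2^n$ chips at the origin). Row $i$ consists of the points with $x+y=i$, ordered left to right by increasing $y$. For $j\ge1$, the minimal row $R(j)$ is the sequence of $j+1$ positive integers defined as follows: if $j=2k-1$, $R(j)=1,3,5,\dots,j,j,\dots,5,3,1$; if $j=2k$, $R(j)=1,3,5,\dots,j-1,j,j-1,\dots,5,3,1$. (E.g. $R(1)=1,1$; $R(2)=1,2,1$; $R(3)=1,3,3,1$.) -}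

module Defs where

open import Data.Nat using (ℕ; zero; suc; _+_; _*_; _∸_; _^_; _/_)
open import Data.Nat.Properties using (_≟_)
open import Data.List using (List; []; _∷_; _++_; map; reverse; filter; upTo)
open import Relation.Nullary using (¬?)

-- F n x y : the chip-firing configuration started with 2^n chips at the
-- origin, on the first quadrant (points outside the quadrant carry 0 chips,
-- so the boundary cases drop the corresponding term).
F : ℕ → ℕ → ℕ → ℕ
F n zero    zero    = 2 ^ n
F n zero    (suc y) = F n zero y / 2
F n (suc x) zero    = F n x zero / 2
F n (suc x) (suc y) = F n x (suc y) / 2 + F n (suc x) y / 2

row : ℕ → ℕ → List ℕ
row n i = map (λ y → F n (i ∸ y) y) (upTo (suc i))

nonzero : List ℕ → List ℕ
nonzero = filter (λ v → ¬? (v ≟ 0))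

odds : ℕ → List ℕ
odds k = map (λ t → 2 * t + 1) (upTo k)

data Parity : Set where
  oddJ  : ℕ → Parity   -- oddJ k  : j = 2k-1
  evenJ : ℕ → Parity   -- evenJ k : j = 2k

parity : ℕ → Parity
parity zero = evenJ 0
parity (suc j) with parity j
... | evenJ k = oddJ (suc k)
... | oddJ k  = evenJ k

-- Minimal row R(j), for j ≥ 1:
--   j = 2k-1 : 1,3,...,j,j,...,3,1
--   j = 2k   : 1,3,...,j-1,j,j-1,...,3,1
R : ℕ → List ℕ
R j with parity j
... | oddJ k  = odds k ++ reverse (odds k)
... | evenJ k = odds k ++ j ∷ reverse (odds k)

{-# OPTIONS --safe #-}
-- Row i+1 arises from row i by firing: every entry sends half of its chips
-- (rounded down) to each of its two neighbours in the next row.  Firing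
-- preserves unimodality, so every row is unimodal; hence the nonzero entries
-- of a row form one contiguous block, and the nonzero part of row i+1 depends
-- only on the nonzero part of row i.  It remains to fire R(j) itself: halving
-- its entries gives the tent 0,1,…,1,0, and adding neighbours gives 0,R(j-1),0.
module Submission where

open import Defs
open import Data.Nat using (ℕ; zero; suc; _+_; _*_; _∸_; _≤_; _/_; z≤n; s≤s)
open import Data.Nat.Properties
  using (+-suc; +-identityʳ; +-comm; +-mono-≤; m≤n+m; ≤-trans; ≤-refl; _≤?_; ≰⇒≥; m+1+n≢0)
open import Data.Nat.DivMod using (/-monoˡ-≤; m/n≡1+[m∸n]/n)
open import Data.List using (List; []; _∷_; _++_; [_]; map; reverse; replicate; applyUpTo; upTo; downFrom)
open import Data.List.Properties
  using (map-++; map-replicate; map-∘; map-cong; map-id; map-upTo; upTo-∷ʳ; reverse-map;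
         reverse-applyUpTo; ++-assoc; ++-identityʳ; ∷ʳ-++; filter-++; filter-all)
open import Data.List.Relation.Unary.All using (All; []; _∷_; universal)
open import Data.List.Relation.Unary.All.Properties using (++⁺; map⁺)
open import Data.Product using (∃; ∃₂; _,_; map₂)
open import Function using (_∘_; id)
open import Relation.Binary.Core using (_Preserves_⟶_)
open import Relation.Binary.PropositionalEquality
  using (_≡_; _≢_; refl; sym; trans; cong; cong₂; subst; module ≡-Reasoning)
open import Relation.Nullary using (yes; no)

open ≡-Reasoning

neighbourSums : ℕ → List ℕ → List ℕ
neighbourSums p []       = [ p ]
neighbourSums p (c ∷ cs) = p + c ∷ neighbourSums c cs

fire : List ℕ → List ℕ
fire l = neighbourSums 0 (map (_/ 2) l)

zeros : ℕ → List ℕ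
zeros p = replicate p 0

nonzero-zeros : ∀ q → nonzero (zeros q) ≡ []
nonzero-zeros zero    = refl
nonzero-zeros (suc q) = nonzero-zeros q

nonzero-padded : ∀ p s q → nonzero (zeros p ++ s ++ zeros q) ≡ nonzero s
nonzero-padded p s q = begin
  nonzero (zeros p ++ s ++ zeros q)
    ≡⟨ filter-++ _ (zeros p) (s ++ zeros q) ⟩
  nonzero (zeros p) ++ nonzero (s ++ zeros q)
    ≡⟨ cong₂ _++_ (nonzero-zeros p) (filter-++ _ s (zeros q)) ⟩
  nonzero s ++ nonzero (zeros q)
    ≡⟨ cong (nonzero s ++_) (nonzero-zeros q) ⟩
  nonzero s ++ []
    ≡⟨ ++-identityʳ (nonzero s) ⟩
  nonzero s ∎

nonzero-positive : ∀ {l} → All (_≢ 0) l → nonzero l ≡ l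
nonzero-positive = filter-all _

neighbourSums-zeros-++ : ∀ p l → neighbourSums 0 (zeros p ++ l) ≡ zeros p ++ neighbourSums 0 l
neighbourSums-zeros-++ zero    l = refl
neighbourSums-zeros-++ (suc p) l = cong (0 ∷_) (neighbourSums-zeros-++ p l)

neighbourSums-++-zeros : ∀ c l q → neighbourSums c (l ++ zeros q) ≡ neighbourSums c l ++ zeros q
neighbourSums-++-zeros c []      zero    = refl
neighbourSums-++-zeros c []      (suc q) = cong₂ _∷_ (+-identityʳ c) (neighbourSums-++-zeros 0 [] q)
neighbourSums-++-zeros c (a ∷ l) q       = cong (c + a ∷_) (neighbourSums-++-zeros a l q)

fire-padded : ∀ p s q → fire (zeros p ++ s ++ zeros q) ≡ zeros p ++ fire s ++ zeros q
fire-padded p s q = begin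
  neighbourSums 0 (map (_/ 2) (zeros p ++ s ++ zeros q))
    ≡⟨ cong (neighbourSums 0) (map-++ (_/ 2) (zeros p) (s ++ zeros q)) ⟩
  neighbourSums 0 (map (_/ 2) (zeros p) ++ map (_/ 2) (s ++ zeros q))
    ≡⟨ cong (neighbourSums 0) (cong₂ _++_ (map-replicate (_/ 2) p 0) (map-++ (_/ 2) s (zeros q))) ⟩
  neighbourSums 0 (zeros p ++ map (_/ 2) s ++ map (_/ 2) (zeros q))
    ≡⟨ cong (λ zs → neighbourSums 0 (zeros p ++ map (_/ 2) s ++ zs)) (map-replicate (_/ 2) q 0) ⟩
  neighbourSums 0 (zeros p ++ map (_/ 2) s ++ zeros q)
    ≡⟨ neighbourSums-zeros-++ p _ ⟩
  zeros p ++ neighbourSums 0 (map (_/ 2) s ++ zeros q)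
    ≡⟨ cong (zeros p ++_) (neighbourSums-++-zeros 0 (map (_/ 2) s) q) ⟩
  zeros p ++ fire s ++ zeros q ∎

data Descending (b : ℕ) : List ℕ → Set where
  []  : Descending b []
  _∷_ : ∀ {a l} → a ≤ b → Descending a l → Descending b (a ∷ l)

data Unimodal (b : ℕ) : List ℕ → Set where
  descend : ∀ {l} → Descending b l → Unimodal b l
  ascend  : ∀ {a l} → b ≤ a → Unimodal a l → Unimodal b (a ∷ l)

unimodal-lower : ∀ {r b l} → r ≤ b → Unimodal b l → Unimodal r l
unimodal-lower _ (descend [])                      = descend []
unimodal-lower {r} _ (descend (_∷_ {a} _ d)) with r ≤? a
... | yes r≤a = ascend r≤a (descend d)
... | no  r≰a = descend (≰⇒≥ r≰a ∷ d)
unimodal-lower r≤b (ascend b≤a u)                  = ascend (≤-trans r≤b b≤a) u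

module _ {f : ℕ → ℕ} (f-mono : f Preserves _≤_ ⟶ _≤_) where

  descending-map : ∀ {b l} → Descending b l → Descending (f b) (map f l)
  descending-map []         = []
  descending-map (a≤b ∷ d)  = f-mono a≤b ∷ descending-map d

  unimodal-map : ∀ {b l} → Unimodal b l → Unimodal (f b) (map f l)
  unimodal-map (descend d)    = descend (descending-map d)
  unimodal-map (ascend b≤a u) = ascend (f-mono b≤a) (unimodal-map u)

descending-neighbourSums : ∀ {p q l} → p ≤ q → Descending p l →
                           Descending (q + p) (neighbourSums p l)
descending-neighbourSums {p} {q} p≤q []        = m≤n+m p q ∷ []
descending-neighbourSums         p≤q (c≤p ∷ d) =
  +-mono-≤ p≤q c≤p ∷ descending-neighbourSums c≤p d

unimodal-neighbourSums : ∀ {p q l} → q ≤ p → Unimodal p l → Unimodal (q + p) (neighbourSums p l)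
unimodal-neighbourSums {p} q≤p (descend d)    =
  unimodal-lower (+-mono-≤ q≤p ≤-refl) (descend (descending-neighbourSums ≤-refl d))
unimodal-neighbourSums     q≤p (ascend p≤a u) =
  ascend (+-mono-≤ q≤p p≤a) (unimodal-neighbourSums p≤a u)

fire-unimodal : ∀ {l} → Unimodal 0 l → Unimodal 0 (fire l)
fire-unimodal u = unimodal-neighbourSums z≤n (unimodal-map (/-monoˡ-≤ 2) u)

descending-zeros : ∀ {l} → Descending 0 l → ∃ λ q → l ≡ zeros q
descending-zeros []        = 0 , refl
descending-zeros (z≤n ∷ d) with q , refl ← descending-zeros d = suc q , refl

descending-support : ∀ {b l} → Descending b l → ∃ λ q → l ≡ nonzero l ++ zeros q
descending-support []                = 0 , refl
descending-support (_∷_ {zero} _ d) with q , refl ← descending-zeros d =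
  suc q , cong (_++ zeros (suc q)) (sym (nonzero-zeros q))
descending-support (_∷_ {suc a} _ d) = map₂ (cong (suc a ∷_)) (descending-support d)

positive-unimodal-support : ∀ {b l} → Unimodal (suc b) l → ∃ λ q → l ≡ nonzero l ++ zeros q
positive-unimodal-support (descend d)                = descending-support d
positive-unimodal-support (ascend {suc a} (s≤s _) u) =
  map₂ (cong (suc a ∷_)) (positive-unimodal-support u)

unimodal-support : ∀ {l} → Unimodal 0 l → ∃₂ λ p q → l ≡ zeros p ++ nonzero l ++ zeros q
unimodal-support (descend d)          = 0 , descending-support d
unimodal-support (ascend {zero} _ u) with p , q , e ← unimodal-support u = suc p , q , cong (0 ∷_) e
unimodal-support (ascend {suc a} _ u) = 0 , map₂ (cong (suc a ∷_)) (positive-unimodal-support u)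

nonzero-fire : ∀ {l} → Unimodal 0 l → nonzero (fire l) ≡ nonzero (fire (nonzero l))
nonzero-fire {l} u with p , q , l≡ ← unimodal-support u = begin
  nonzero (fire l)                                    ≡⟨ cong (nonzero ∘ fire) l≡ ⟩
  nonzero (fire (zeros p ++ nonzero l ++ zeros q))    ≡⟨ cong nonzero (fire-padded p (nonzero l) q) ⟩
  nonzero (zeros p ++ fire (nonzero l) ++ zeros q)    ≡⟨ nonzero-padded p (fire (nonzero l)) q ⟩
  nonzero (fire (nonzero l))                          ∎

antidiagonal : ℕ → ℕ → ℕ → List ℕ
antidiagonal n zero    y = [ F n zero y ]
antidiagonal n (suc x) y = F n (suc x) y ∷ antidiagonal n x (suc y)

applyUpTo-antidiagonal : ∀ n x y (g : ℕ → ℕ) → (∀ t → g t ≡ F n (x ∸ t) (y + t)) →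
                         applyUpTo g (suc x) ≡ antidiagonal n x y
applyUpTo-antidiagonal n zero    y g g≡ = cong [_] (trans (g≡ 0) (cong (F n 0) (+-identityʳ y)))
applyUpTo-antidiagonal n (suc x) y g g≡ =
  cong₂ _∷_ (trans (g≡ 0) (cong (F n (suc x)) (+-identityʳ y)))
            (applyUpTo-antidiagonal n x (suc y) (g ∘ suc) g∘suc≡)
  where
  g∘suc≡ : ∀ t → g (suc t) ≡ F n (x ∸ t) (suc y + t)
  g∘suc≡ t = trans (g≡ (suc t)) (cong (F n (x ∸ t)) (+-suc y t))

row≡antidiagonal : ∀ n i → row n i ≡ antidiagonal n i 0
row≡antidiagonal n i = trans (map-upTo _ (suc i)) (applyUpTo-antidiagonal n i 0 _ (λ _ → refl))

antidiagonal-suc : ∀ n x y →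
  antidiagonal n (suc x) (suc y) ≡ neighbourSums (F n (suc x) y / 2) (map (_/ 2) (antidiagonal n x (suc y)))
antidiagonal-suc n zero    y = cong (_∷ [ F n 0 (suc y) / 2 ]) (+-comm (F n 0 (suc y) / 2) (F n 1 y / 2))
antidiagonal-suc n (suc x) y =
  cong₂ _∷_ (+-comm (F n (suc x) (suc y) / 2) (F n (suc (suc x)) y / 2)) (antidiagonal-suc n x (suc y))

row-suc : ∀ n i → row n (suc i) ≡ fire (row n i)
row-suc n i = begin
  row n (suc i)                   ≡⟨ row≡antidiagonal n (suc i) ⟩
  antidiagonal n (suc i) 0        ≡⟨ fire-antidiagonal i ⟩
  fire (antidiagonal n i 0)       ≡⟨ cong fire (row≡antidiagonal n i) ⟨
  fire (row n i)                  ∎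
  where
  fire-antidiagonal : ∀ x → antidiagonal n (suc x) 0 ≡ fire (antidiagonal n x 0)
  fire-antidiagonal zero    = refl
  fire-antidiagonal (suc x) = cong (F n (suc (suc x)) 0 ∷_) (antidiagonal-suc n x 0)

row-unimodal : ∀ n i → Unimodal 0 (row n i)
row-unimodal n zero    = ascend z≤n (descend [])
row-unimodal n (suc i) = subst (Unimodal 0) (sym (row-suc n i)) (fire-unimodal (row-unimodal n i))

[2+n]/2≡1+n/2 : ∀ n → suc (suc n) / 2 ≡ suc (n / 2)
[2+n]/2≡1+n/2 n = m/n≡1+[m∸n]/n {suc (suc n)} (s≤s (s≤s z≤n))

[n+n]/2≡n : ∀ n → (n + n) / 2 ≡ n
[n+n]/2≡n zero    = refl
[n+n]/2≡n (suc n) = begin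
  suc (n + suc n) / 2   ≡⟨ cong (λ m → suc m / 2) (+-suc n n) ⟩
  suc (suc (n + n)) / 2 ≡⟨ [2+n]/2≡1+n/2 (n + n) ⟩
  suc ((n + n) / 2)     ≡⟨ cong suc ([n+n]/2≡n n) ⟩
  suc n                 ∎

[1+n+n]/2≡n : ∀ n → suc (n + n) / 2 ≡ n
[1+n+n]/2≡n zero    = refl
[1+n+n]/2≡n (suc n) = begin
  suc (suc (n + suc n)) / 2   ≡⟨ cong (λ m → suc (suc m) / 2) (+-suc n n) ⟩
  suc (suc (suc (n + n))) / 2 ≡⟨ [2+n]/2≡1+n/2 (suc (n + n)) ⟩
  suc (suc (n + n) / 2)       ≡⟨ cong suc ([1+n+n]/2≡n n) ⟩
  suc n                       ∎

2n+1≡1+n+n : ∀ n → 2 * n + 1 ≡ suc (n + n)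
2n+1≡1+n+n n = trans (+-comm (2 * n) 1) (cong (λ m → suc (n + m)) (+-identityʳ n))

map-half-odd : ∀ xs → map (_/ 2) (map (λ t → 2 * t + 1) xs) ≡ xs
map-half-odd xs = begin
  map (_/ 2) (map (λ t → 2 * t + 1) xs) ≡⟨ map-∘ xs ⟨
  map (λ t → (2 * t + 1) / 2) xs
    ≡⟨ map-cong (λ t → trans (cong (_/ 2) (2n+1≡1+n+n t)) ([1+n+n]/2≡n t)) xs ⟩
  map id xs                             ≡⟨ map-id xs ⟩
  xs                                    ∎

odd-positive : ∀ xs → All (_≢ 0) (map (λ t → 2 * t + 1) xs)
odd-positive xs = map⁺ (universal (λ t → m+1+n≢0 (2 * t)) xs)

oddsDown : ℕ → List ℕ
oddsDown k = map (λ t → 2 * t + 1) (downFrom k)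

reverse-odds : ∀ k → reverse (odds k) ≡ oddsDown k
reverse-odds k = trans (sym (reverse-map _ (upTo k))) (cong (map _) (reverse-applyUpTo id k))

neighbourSums-applyUpTo : ∀ (f : ℕ → ℕ) k t →
  neighbourSums (f 0) (applyUpTo (f ∘ suc) k ++ t) ≡
  applyUpTo (λ i → f i + f (suc i)) k ++ neighbourSums (f k) t
neighbourSums-applyUpTo f zero    t = refl
neighbourSums-applyUpTo f (suc k) t = cong (f 0 + f 1 ∷_) (neighbourSums-applyUpTo (f ∘ suc) k t)

neighbourSums-upTo : ∀ k t → neighbourSums 0 (upTo (suc k) ++ t) ≡ 0 ∷ odds k ++ neighbourSums k t
neighbourSums-upTo k t = cong (0 ∷_) (begin
  neighbourSums 0 (applyUpTo suc k ++ t)               ≡⟨ neighbourSums-applyUpTo id k t ⟩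
  applyUpTo (λ i → i + suc i) k ++ neighbourSums k t   ≡⟨ cong (_++ neighbourSums k t) odds≡ ⟨
  odds k ++ neighbourSums k t                          ∎)
  where
  odds≡ : odds k ≡ applyUpTo (λ i → i + suc i) k
  odds≡ = trans (map-cong (λ i → trans (2n+1≡1+n+n i) (sym (+-suc i i))) (upTo k)) (map-upTo _ k)

neighbourSums-downFrom : ∀ k → neighbourSums k (downFrom k) ≡ oddsDown k ++ [ 0 ]
neighbourSums-downFrom zero    = refl
neighbourSums-downFrom (suc k) = cong₂ _∷_ (sym (2n+1≡1+n+n k)) (neighbourSums-downFrom k)

data EvenOrOdd : ℕ → Set where
  even : ∀ k → EvenOrOdd (k + k)
  odd  : ∀ k → EvenOrOdd (suc (k + k))

evenOrOdd : ∀ j → EvenOrOdd j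
evenOrOdd zero = even 0
evenOrOdd (suc j) with evenOrOdd j
... | even k = odd k
... | odd  k = subst EvenOrOdd (cong suc (+-suc k k)) (even (suc k))

parity-even : ∀ k → parity (k + k) ≡ evenJ k
parity-even zero = refl
parity-even (suc k) rewrite +-suc k k | parity-even k = refl

R-2k : ∀ k → R (k + k) ≡ odds k ++ (k + k) ∷ oddsDown k
R-2k k rewrite parity-even k = cong (λ l → odds k ++ (k + k) ∷ l) (reverse-odds k)

R-2k+1 : ∀ k → R (suc (k + k)) ≡ odds (suc k) ++ oddsDown (suc k)
R-2k+1 k rewrite parity-even k = cong (odds (suc k) ++_) (reverse-odds (suc k))

R-2k+2 : ∀ k → R (suc (suc (k + k))) ≡ odds (suc k) ++ suc (suc (k + k)) ∷ oddsDown (suc k)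
R-2k+2 k rewrite parity-even k =
  cong (λ l → odds (suc k) ++ suc (suc (k + k)) ∷ l) (reverse-odds (suc k))

R-positive : ∀ j → All (_≢ 0) (R (suc j))
R-positive j with evenOrOdd j
... | even k = subst (All (_≢ 0)) (sym (R-2k+1 k))
                 (++⁺ (odd-positive (upTo (suc k))) (odd-positive (downFrom (suc k))))
... | odd  k = subst (All (_≢ 0)) (sym (R-2k+2 k))
                 (++⁺ (odd-positive (upTo (suc k))) ((λ ()) ∷ odd-positive (downFrom (suc k))))

upTo-suc-++ : ∀ k t → upTo (suc k) ++ t ≡ upTo k ++ k ∷ t
upTo-suc-++ k t = trans (cong (_++ t) (sym (upTo-∷ʳ k))) (∷ʳ-++ (upTo k) k t)

map-half-R-2k+1 : ∀ k → map (_/ 2) (R (suc (k + k))) ≡ upTo (suc k) ++ downFrom (suc k)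
map-half-R-2k+1 k = begin
  map (_/ 2) (R (suc (k + k)))                                  ≡⟨ cong (map (_/ 2)) (R-2k+1 k) ⟩
  map (_/ 2) (odds (suc k) ++ oddsDown (suc k))                 ≡⟨ map-++ (_/ 2) (odds (suc k)) _ ⟩
  map (_/ 2) (odds (suc k)) ++ map (_/ 2) (oddsDown (suc k))
    ≡⟨ cong₂ _++_ (map-half-odd (upTo (suc k))) (map-half-odd (downFrom (suc k))) ⟩
  upTo (suc k) ++ downFrom (suc k)                              ∎

map-half-R-2k+2 : ∀ k → map (_/ 2) (R (suc (suc (k + k)))) ≡ upTo (suc (suc k)) ++ downFrom (suc k)
map-half-R-2k+2 k = begin
  map (_/ 2) (R (suc (suc (k + k))))                            ≡⟨ cong (map (_/ 2)) (R-2k+2 k) ⟩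
  map (_/ 2) (odds (suc k) ++ suc (suc (k + k)) ∷ oddsDown (suc k))
    ≡⟨ map-++ (_/ 2) (odds (suc k)) _ ⟩
  map (_/ 2) (odds (suc k)) ++ suc (suc (k + k)) / 2 ∷ map (_/ 2) (oddsDown (suc k))
    ≡⟨ cong₂ (λ xs x → xs ++ x ∷ map (_/ 2) (oddsDown (suc k)))
             (map-half-odd (upTo (suc k))) half-2k+2 ⟩
  upTo (suc k) ++ suc k ∷ map (_/ 2) (oddsDown (suc k))
    ≡⟨ cong (λ xs → upTo (suc k) ++ suc k ∷ xs) (map-half-odd (downFrom (suc k))) ⟩
  upTo (suc k) ++ suc k ∷ downFrom (suc k)                      ≡⟨ upTo-suc-++ (suc k) _ ⟨
  upTo (suc (suc k)) ++ downFrom (suc k)                        ∎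
  where
  half-2k+2 : suc (suc (k + k)) / 2 ≡ suc k
  half-2k+2 = trans ([2+n]/2≡1+n/2 (k + k)) (cong suc ([n+n]/2≡n k))

fire-R-2k+1 : ∀ k → fire (R (suc (k + k))) ≡ 0 ∷ R (k + k) ++ [ 0 ]
fire-R-2k+1 k = begin
  neighbourSums 0 (map (_/ 2) (R (suc (k + k))))        ≡⟨ cong (neighbourSums 0) (map-half-R-2k+1 k) ⟩
  neighbourSums 0 (upTo (suc k) ++ downFrom (suc k))    ≡⟨ neighbourSums-upTo k (downFrom (suc k)) ⟩
  0 ∷ odds k ++ (k + k) ∷ neighbourSums k (downFrom k)
    ≡⟨ cong (λ xs → 0 ∷ odds k ++ (k + k) ∷ xs) (neighbourSums-downFrom k) ⟩
  0 ∷ odds k ++ (k + k) ∷ oddsDown k ++ [ 0 ]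
    ≡⟨ cong (0 ∷_) (++-assoc (odds k) ((k + k) ∷ oddsDown k) [ 0 ]) ⟨
  0 ∷ (odds k ++ (k + k) ∷ oddsDown k) ++ [ 0 ]
    ≡⟨ cong (λ xs → 0 ∷ xs ++ [ 0 ]) (R-2k k) ⟨
  0 ∷ R (k + k) ++ [ 0 ]                                ∎

fire-R-2k+2 : ∀ k → fire (R (suc (suc (k + k)))) ≡ 0 ∷ R (suc (k + k)) ++ [ 0 ]
fire-R-2k+2 k = begin
  neighbourSums 0 (map (_/ 2) (R (suc (suc (k + k)))))  ≡⟨ cong (neighbourSums 0) (map-half-R-2k+2 k) ⟩
  neighbourSums 0 (upTo (suc (suc k)) ++ downFrom (suc k))
    ≡⟨ neighbourSums-upTo (suc k) (downFrom (suc k)) ⟩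
  0 ∷ odds (suc k) ++ neighbourSums (suc k) (downFrom (suc k))
    ≡⟨ cong (λ xs → 0 ∷ odds (suc k) ++ xs) (neighbourSums-downFrom (suc k)) ⟩
  0 ∷ odds (suc k) ++ oddsDown (suc k) ++ [ 0 ]
    ≡⟨ cong (0 ∷_) (++-assoc (odds (suc k)) (oddsDown (suc k)) [ 0 ]) ⟨
  0 ∷ (odds (suc k) ++ oddsDown (suc k)) ++ [ 0 ]
    ≡⟨ cong (λ xs → 0 ∷ xs ++ [ 0 ]) (R-2k+1 k) ⟨
  0 ∷ R (suc (k + k)) ++ [ 0 ]                          ∎

fire-R : ∀ j → fire (R (suc j)) ≡ 0 ∷ R j ++ [ 0 ]
fire-R j with evenOrOdd j
... | even k = fire-R-2k+1 k
... | odd  k = fire-R-2k+2 k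

nonzero-fire-R : ∀ {j} → 2 ≤ j → nonzero (fire (R j)) ≡ R (j ∸ 1)
nonzero-fire-R {suc (suc m)} (s≤s (s≤s z≤n)) = begin
  nonzero (fire (R (suc (suc m))))           ≡⟨ cong nonzero (fire-R (suc m)) ⟩
  nonzero (zeros 1 ++ R (suc m) ++ zeros 1)  ≡⟨ nonzero-padded 1 (R (suc m)) 1 ⟩
  nonzero (R (suc m))                        ≡⟨ nonzero-positive (R-positive m) ⟩
  R (suc m)                                  ∎

lemma7p1 : (n j i : ℕ) → 2 ≤ j → nonzero (row n i) ≡ R j →
    nonzero (row n (suc i)) ≡ R (j ∸ 1)
lemma7p1 n j i 2≤j row-i≡R = begin
  nonzero (row n (suc i))             ≡⟨ cong nonzero (row-suc n i) ⟩
  nonzero (fire (row n i))            ≡⟨ nonzero-fire (row-unimodal n i) ⟩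
  nonzero (fire (nonzero (row n i)))  ≡⟨ cong (nonzero ∘ fire) row-i≡R ⟩
  nonzero (fire (R j))                ≡⟨ nonzero-fire-R 2≤j ⟩
  R (j ∸ 1)                           ∎
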